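{- For each odd integer $N\geq 3$ there is at least one integer triple $(a,b,c)$ with $0<a+1<b<c$, $c-a=N$, and $$(a+1)^2+\cdots+b^2=(b+1)^2+\cdots+c^2 .$$ Furthermore, for each odd $N\ge 3$ there is a plane $\Pi_N\subset\mathbb{R}^3$ and an infinite family of distinct integer triples $(a_n,b_n,c_n)$, each satisfying $0<a_n+1<b_n<c_n$ and $(a_n+1)^2+\cdots+b_n^2=(b_n+1)^2+\cdots+c_n^2$, all lying in $\Pi_N$ and all having $c_n-a_n$ odd; moreover the planes $\Pi_N$ are different for different $N$. -}

module Defs where

open import Data.Nat using (ℕ; zero; suc; _+_; _*_; _∸_; _^_; _<_; _≤_)
open import Data.Integer as ℤ using (ℤ; +_)
open import Data.List using (List; map; upTo)
open import Data.Nat.ListAction using (sum)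
open import Data.Product using (_×_; Σ; ∃; _,_)
open import Relation.Binary.PropositionalEquality using (_≡_)
open import Relation.Nullary using (¬_)

Odd : ℕ → Set
Odd n = ∃ λ k → n ≡ suc (2 * k)

-- (a+1)^2 + (a+2)^2 + ... + b^2   (empty sum = 0 if b ≤ a)
sqSum : ℕ → ℕ → ℕ
sqSum a b = sum (map (λ i → (a + 1 + i) ^ 2) (upTo (b ∸ a)))

-- A triple (a,b,c) with 0 < a+1 < b < c and
-- (a+1)^2+...+b^2 = (b+1)^2+...+c^2.
-- (Since a+1 > 0 forces a ≥ 0, all three are naturals.)
Good : ℕ → ℕ → ℕ → Set
Good a b c = (0 < a + 1) × (a + 1 < b) × (b < c) × (sqSum a b ≡ sqSum b c)

Triple : Set
Triple = ℕ × ℕ × ℕ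

-- A plane in ℝ³ given by α x + β y + γ z = δ with (α,β,γ) ≠ 0.
-- Integer coefficients suffice.
record Plane : Set where
  constructor plane
  field
    α β γ δ : ℤ
    normal≢0 : ¬ (α ≡ + 0 × β ≡ + 0 × γ ≡ + 0)

open Plane public

OnPlane : Plane → Triple → Set
OnPlane P (x , y , z) =
  α P ℤ.* + x ℤ.+ β P ℤ.* + y ℤ.+ γ P ℤ.* + z ≡ δ P

-- Two equations describe the same plane iff their coefficient vectors
-- (α,β,γ,δ) are proportional, i.e. all 2×2 minors vanish.
SamePlane : Plane → Plane → Set
SamePlane P Q =
  (α P ℤ.* β Q ≡ β P ℤ.* α Q) × (α P ℤ.* γ Q ≡ γ P ℤ.* α Q) ×
  (α P ℤ.* δ Q ≡ δ P ℤ.* α Q) × (β P ℤ.* γ Q ≡ γ P ℤ.* β Q) ×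
  (β P ℤ.* δ Q ≡ δ P ℤ.* β Q) × (γ P ℤ.* δ Q ≡ δ P ℤ.* γ Q)

{-# OPTIONS --safe #-}
module Submission where

open import Defs
open import Data.Nat using (ℕ; _≤_; _∸_)
open import Data.Product using (_×_; ∃; _,_)
open import Function.Definitions using (Injective)
open import Relation.Binary.PropositionalEquality using (_≡_; _≢_)
open import Relation.Nullary using (¬_)

open import Data.Nat
  using (zero; suc; pred; _+_; _*_; _^_; _<_; s≤s; z≤n; z<s; NonZero; >-nonZero⁻¹; ⌊_/2⌋)
open import Data.Nat.Properties
open import Data.Nat.ListAction using (sum)
open import Data.Nat.ListAction.Properties using (sum-++)
open import Data.Nat.Tactic.RingSolver using (solve-∀)
open import Data.Integer as ℤ using (+_; -[1+_])
import Data.Integer.Properties as ℤ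
open import Data.Integer.Tactic.RingSolver renaming (solve-∀ to ℤ-solve-∀)
open import Data.List using ([_]; _∷ʳ_; _++_; map; upTo)
open import Data.List.Properties using (map-++; upTo-∷ʳ)
open import Data.Product using (proj₁; proj₂)
open import Data.Sum using (inj₁; inj₂)
open import Function using (_∘_)
open import Relation.Binary.Definitions using (tri<; tri≈; tri>)
open import Relation.Binary.PropositionalEquality
  using (refl; sym; trans; cong; cong₂; subst; module ≡-Reasoning)
open import Relation.Nullary using (contradiction)

-- With G x = x (x + 1) (2x + 1) = 6 (1² + ⋯ + x²) the equation reads 2 G b = G a + G c.
-- For N = 2k + 1 take b − a = (k + 1) t and c − b = k t with t odd: such triples lie on
-- the plane k a − (2k + 1) b + (k + 1) c = 0 and have c − a = N t. On them
-- 2 (2 G b − G a − G c) is t times 12 z² − D t² − 1, where h = k (k + 1), D = 12 h² − 1 and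
-- z = b − h t − (t − 1)/2. This Pell equation has the solution (z, t) = (h, 1), which gives
-- c − a = N, and infinitely many more with t increasing, obtained by composing with the
-- solution (2D + 1, 2h) of X² − 12 D Y² = 1.

sixPyramidal : ℕ → ℕ
sixPyramidal x = x * (x + 1) * (2 * x + 1)

sum-map-upTo-suc : ∀ (f : ℕ → ℕ) n → sum (map f (upTo (suc n))) ≡ sum (map f (upTo n)) + f n
sum-map-upTo-suc f n = begin
  sum (map f (upTo (suc n)))         ≡⟨ cong (sum ∘ map f) (upTo-∷ʳ n) ⟨
  sum (map f (upTo n ∷ʳ n))          ≡⟨ cong sum (map-++ f (upTo n) [ n ]) ⟩
  sum (map f (upTo n) ++ [ f n ])    ≡⟨ sum-++ (map f (upTo n)) [ f n ] ⟩
  sum (map f (upTo n)) + (f n + 0)   ≡⟨ cong (_+_ (sum (map f (upTo n)))) (+-identityʳ (f n)) ⟩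
  sum (map f (upTo n)) + f n         ∎
  where open ≡-Reasoning

sqSum-shifted-closedForm : ∀ a d →
  6 * sum (map (λ i → (a + 1 + i) ^ 2) (upTo d)) + sixPyramidal a ≡ sixPyramidal (a + d)
sqSum-shifted-closedForm a zero = cong sixPyramidal (sym (+-identityʳ a))
sqSum-shifted-closedForm a (suc d) = begin
  6 * S (suc d) + G a                   ≡⟨ cong (λ s → 6 * s + G a) (sum-map-upTo-suc f d) ⟩
  6 * (S d + f d) + G a                 ≡⟨ regroup (S d) (a + 1 + d) (G a) ⟩
  (6 * S d + G a) + 6 * (m * m)         ≡⟨ cong (_+ 6 * (m * m)) (sqSum-shifted-closedForm a d) ⟩
  G (a + d) + 6 * (m * m)               ≡⟨ sixPyramidal-step a d ⟩
  G (a + suc d)                         ∎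
  where
  open ≡-Reasoning
  G = sixPyramidal
  m = a + 1 + d
  f : ℕ → ℕ
  f i = (a + 1 + i) ^ 2
  S : ℕ → ℕ
  S n = sum (map f (upTo n))
  regroup : ∀ s x g → 6 * (s + x * (x * 1)) + g ≡ (6 * s + g) + 6 * (x * x)
  regroup = solve-∀
  sixPyramidal-step : ∀ a d → let G x = x * (x + 1) * (2 * x + 1) in
    G (a + d) + 6 * ((a + 1 + d) * (a + 1 + d)) ≡ G (a + suc d)
  sixPyramidal-step = solve-∀

sqSum-closedForm : ∀ {a b} → a ≤ b → 6 * sqSum a b + sixPyramidal a ≡ sixPyramidal b
sqSum-closedForm {a} {b} a≤b =
  subst (λ x → 6 * sqSum a b + sixPyramidal a ≡ sixPyramidal x) (m+[n∸m]≡n a≤b)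
        (sqSum-shifted-closedForm a (b ∸ a))

sqSum-balanced : ∀ {a b c} → a ≤ b → b ≤ c →
  2 * sixPyramidal b ≡ sixPyramidal a + sixPyramidal c → sqSum a b ≡ sqSum b c
sqSum-balanced {a} {b} {c} a≤b b≤c balance = *-cancelˡ-≡ _ _ 6 (+-cancelʳ-≡ _ _ _ (begin
  6 * sqSum a b + (G a + G b)     ≡⟨ +-assoc (6 * sqSum a b) (G a) (G b) ⟨
  6 * sqSum a b + G a + G b       ≡⟨ cong (_+ G b) (sqSum-closedForm a≤b) ⟩
  G b + G b                       ≡⟨ cong (_+_ (G b)) (+-identityʳ (G b)) ⟨
  2 * G b                         ≡⟨ balance ⟩
  G a + G c                       ≡⟨ cong (_+_ (G a)) (sqSum-closedForm b≤c) ⟨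
  G a + (6 * sqSum b c + G b)     ≡⟨ x+[y+z]≡y+[x+z] (G a) (6 * sqSum b c) (G b) ⟩
  6 * sqSum b c + (G a + G b)     ∎))
  where
  open ≡-Reasoning
  G = sixPyramidal
  x+[y+z]≡y+[x+z] : ∀ x y z → x + (y + z) ≡ y + (x + z)
  x+[y+z]≡y+[x+z] = solve-∀

Odd-* : ∀ {m n} → Odd m → Odd n → Odd (m * n)
Odd-* (j , refl) (k , refl) = j + k + 2 * j * k , odd-product j k
  where
  odd-product : ∀ j k → suc (2 * j) * suc (2 * k) ≡ suc (2 * (j + k + 2 * j * k))
  odd-product = solve-∀

increasing⇒monotone : ∀ {f : ℕ → ℕ} → (∀ n → f n < f (suc n)) →
  ∀ {m n} → m < n → f m < f n
increasing⇒monotone inc {m} {suc n} (s≤s m≤n) with m≤n⇒m<n∨m≡n m≤n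
... | inj₁ m<n  = <-trans (increasing⇒monotone inc m<n) (inc n)
... | inj₂ refl = inc m

increasing⇒injective : ∀ {f : ℕ → ℕ} → (∀ n → f n < f (suc n)) → Injective _≡_ _≡_ f
increasing⇒injective inc {m} {n} fm≡fn with <-cmp m n
... | tri< m<n _ _ = contradiction fm≡fn (<⇒≢ (increasing⇒monotone inc m<n))
... | tri≈ _ m≡n _ = m≡n
... | tri> _ _ n<m = contradiction (sym fm≡fn) (<⇒≢ (increasing⇒monotone inc n<m))

module Pell (A D : ℕ) where

  IsSolution : ℕ × ℕ → Set
  IsSolution (z , t) = A * (z * z) ≡ D * (t * t) + 1

  IsUnit : ℕ × ℕ → Set
  IsUnit (X , Y) = X * X ≡ A * D * (Y * Y) + 1

  compose : ℕ × ℕ → ℕ × ℕ → ℕ × ℕ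
  compose (X , Y) (z , t) = X * z + D * Y * t , A * Y * z + X * t

  -- Brahmagupta's identity A z′² − D t′² = (X² − A D Y²) (A z² − D t²), rearranged
  -- without subtraction.
  private
    brahmagupta : ∀ A D X Y z t → let z′ = X * z + D * Y * t ; t′ = A * Y * z + X * t in
      A * (z′ * z′) + (D * (t * t) * (X * X) + A * D * (Y * Y) * (A * (z * z)))
        ≡ D * (t′ * t′) + (A * (z * z) * (X * X) + A * D * (Y * Y) * (D * (t * t)))
    brahmagupta = solve-∀

    expand : ∀ T U Q → Q + ((T + 1) * (U + 1) + U * T) ≡ Q + 1 + (T * (U + 1) + U * (T + 1))
    expand = solve-∀

  isSolution⇒z>0 : ∀ {z t} → IsSolution (z , t) → 0 < z
  isSolution⇒z>0 {zero}  sol = contradiction (trans (sym sol) (*-zeroʳ A)) (m+1+n≢0 _)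
  isSolution⇒z>0 {suc _} _   = z<s

  compose-isSolution : ∀ {u s} → IsUnit u → IsSolution s → IsSolution (compose u s)
  compose-isSolution {X , Y} {z , t} unit sol = +-cancelʳ-≡ _ _ _ (begin
    A * (z′ * z′) + (T * (U + 1) + U * (T + 1))
      ≡⟨ cong₂ (λ p q → A * (z′ * z′) + (T * p + U * q)) unit sol ⟨
    A * (z′ * z′) + (T * (X * X) + U * (A * (z * z)))
      ≡⟨ brahmagupta A D X Y z t ⟩
    D * (t′ * t′) + (A * (z * z) * (X * X) + U * T)
      ≡⟨ cong₂ (λ p q → D * (t′ * t′) + (q * p + U * T)) unit sol ⟩
    D * (t′ * t′) + ((T + 1) * (U + 1) + U * T)
      ≡⟨ expand T U (D * (t′ * t′)) ⟩
    D * (t′ * t′) + 1 + (T * (U + 1) + U * (T + 1)) ∎)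
    where
    open ≡-Reasoning
    z′ = X * z + D * Y * t
    t′ = A * Y * z + X * t
    T = D * (t * t)
    U = A * D * (Y * Y)

module PellSequence (A h : ℕ) .{{A≢0 : NonZero A}} .{{_ : NonZero h}} where

  D : ℕ
  D = pred (A * (h * h))

  open Pell A D

  Ah²≡1+D : A * (h * h) ≡ suc D
  Ah²≡1+D = sym (suc-pred (A * (h * h)) {{m*n≢0 A (h * h) {{A≢0}} {{m*n≢0 h h}}}})

  unit : ℕ × ℕ
  unit = suc (2 * D) , 2 * h

  unit-isUnit : IsUnit unit
  unit-isUnit = begin
    suc (2 * D) * suc (2 * D)         ≡⟨ square-odd D ⟩
    4 * D * suc D + 1                 ≡⟨ cong (λ x → 4 * D * x + 1) Ah²≡1+D ⟨
    4 * D * (A * (h * h)) + 1         ≡⟨ cong (_+ 1) (regroup A D h) ⟩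
    A * D * (2 * h * (2 * h)) + 1     ∎
    where
    open ≡-Reasoning
    square-odd : ∀ D → suc (2 * D) * suc (2 * D) ≡ 4 * D * suc D + 1
    square-odd = solve-∀
    regroup : ∀ A D h → 4 * D * (A * (h * h)) ≡ A * D * (2 * h * (2 * h))
    regroup = solve-∀

  solution : ℕ → ℕ × ℕ
  solution zero    = h , 1
  solution (suc n) = compose unit (solution n)

  z t : ℕ → ℕ
  z n = proj₁ (solution n)
  t n = proj₂ (solution n)

  solution-isSolution : ∀ n → IsSolution (solution n)
  solution-isSolution zero    =
    trans Ah²≡1+D (trans (+-comm 1 D) (cong (_+ 1) (sym (*-identityʳ D))))
  solution-isSolution (suc n) =
    compose-isSolution {unit} {solution n} unit-isUnit (solution-isSolution n)

  isSolution⇒Az²+t²≡Ah²t²+1 : ∀ {z t} → IsSolution (z , t) →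
    A * (z * z) + t * t ≡ A * (h * h) * (t * t) + 1
  isSolution⇒Az²+t²≡Ah²t²+1 {z} {t} sol = begin
    A * (z * z) + t * t           ≡⟨ cong (_+ t * t) sol ⟩
    D * (t * t) + 1 + t * t       ≡⟨ regroup D (t * t) ⟩
    suc D * (t * t) + 1           ≡⟨ cong (λ x → x * (t * t) + 1) Ah²≡1+D ⟨
    A * (h * h) * (t * t) + 1     ∎
    where
    open ≡-Reasoning
    regroup : ∀ D s → D * s + 1 + s ≡ suc D * s + 1
    regroup = solve-∀

  t-odd : ∀ n → Odd (t n)
  t-odd zero = 0 , refl
  t-odd (suc n) with t-odd n
  ... | j , tₙ≡1+2j = A * h * z n + D * suc (2 * j) + j ,
    trans (cong (λ x → A * (2 * h) * z n + suc (2 * D) * x) tₙ≡1+2j) (odd-step A D h (z n) j)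
    where
    odd-step : ∀ A D h z j →
      A * (2 * h) * z + suc (2 * D) * suc (2 * j) ≡ suc (2 * (A * h * z + D * suc (2 * j) + j))
    odd-step = solve-∀

  t-increasing : ∀ n → t n < t (suc n)
  t-increasing n = begin-strict
    t n                                    <⟨ m<n+m (t n) A·2h·z>0 ⟩
    A * (2 * h) * z n + t n                ≤⟨ +-monoʳ-≤ _ (m≤m+n (t n) (2 * D * t n)) ⟩
    A * (2 * h) * z n + suc (2 * D) * t n  ∎
    where
    open ≤-Reasoning
    A·2h·z>0 : 0 < A * (2 * h) * z n
    A·2h·z>0 = *-mono-< (*-mono-< (>-nonZero⁻¹ A) (*-mono-< {0} {2} z<s (>-nonZero⁻¹ h)))
                        (isSolution⇒z>0 {z n} {t n} (solution-isSolution n))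

balancePlane : ℕ → Plane
balancePlane k = plane (+ k) -[1+ 2 * k ] (+ suc k) (+ 0) λ { (_ , _ , ()) }

balancePlane-∋ : ∀ k ((a , b , c) : Triple) →
  k * a + suc k * c ≡ suc (2 * k) * b → OnPlane (balancePlane k) (a , b , c)
balancePlane-∋ k (a , b , c) e = begin
  + k ℤ.* + a ℤ.+ -[1+ 2 * k ] ℤ.* + b ℤ.+ + suc k ℤ.* + c
    ≡⟨ cong (λ w → + k ℤ.* + a ℤ.+ w ℤ.+ + suc k ℤ.* + c)
            (ℤ.neg-distribˡ-* (+ suc (2 * k)) (+ b)) ⟨
  + k ℤ.* + a ℤ.+ ℤ.- (+ suc (2 * k) ℤ.* + b) ℤ.+ + suc k ℤ.* + c
    ≡⟨ regroup (+ k ℤ.* + a) (+ suc (2 * k) ℤ.* + b) (+ suc k ℤ.* + c) ⟩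
  (+ k ℤ.* + a ℤ.+ + suc k ℤ.* + c) ℤ.- + suc (2 * k) ℤ.* + b
    ≡⟨ cong₂ ℤ._-_ (cong₂ ℤ._+_ (ℤ.pos-* k a) (ℤ.pos-* (suc k) c))
                   (ℤ.pos-* (suc (2 * k)) b) ⟨
  + (k * a + suc k * c) ℤ.- + (suc (2 * k) * b)
    ≡⟨ cong (λ x → + x ℤ.- + (suc (2 * k) * b)) e ⟩
  + (suc (2 * k) * b) ℤ.- + (suc (2 * k) * b)
    ≡⟨ ℤ.+-inverseʳ (+ (suc (2 * k) * b)) ⟩
  + 0 ∎
  where
  open ≡-Reasoning
  regroup : ∀ x y z → x ℤ.+ ℤ.- y ℤ.+ z ≡ (x ℤ.+ z) ℤ.- y
  regroup = ℤ-solve-∀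

balancePlane-injective : ∀ {k l} → SamePlane (balancePlane k) (balancePlane l) → k ≡ l
balancePlane-injective {k} {l} (αβ′≡βα′ , _) = +-cancelʳ-≡ (2 * k * l) k l (begin
  k + 2 * k * l             ≡⟨ expandˡ k l ⟩
  k * suc (2 * l)           ≡⟨ ℤ.abs-* (+ k) -[1+ 2 * l ] ⟨
  ℤ.∣ + k ℤ.* -[1+ 2 * l ] ∣ ≡⟨ cong ℤ.∣_∣ αβ′≡βα′ ⟩
  ℤ.∣ -[1+ 2 * k ] ℤ.* + l ∣ ≡⟨ ℤ.abs-* -[1+ 2 * k ] (+ l) ⟩
  suc (2 * k) * l           ≡⟨ expandʳ k l ⟨
  l + 2 * k * l             ∎)
  where
  open ≡-Reasoning
  expandˡ : ∀ k l → k + 2 * k * l ≡ k * suc (2 * l)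
  expandˡ = solve-∀
  expandʳ : ∀ k l → l + 2 * k * l ≡ suc (2 * k) * l
  expandʳ = solve-∀

-- The family for N = 2k + 1 with k = K + 1.
module BalancedFamily (K : ℕ) where

  h : ℕ
  h = suc K * (2 + K)

  open PellSequence 12 h
    renaming (z to zₙ; t to tₙ; t-odd to tₙ-odd; t-increasing to tₙ-increasing)
  open Pell 12 D using (IsSolution)

  -- b − a = (k + 1) t and c − b = k t for t = 2i + 1; a is offset so that z = b − h t − i.
  triple : ℕ → ℕ → Triple
  triple z i = a , a + (2 + K) * t , a + (2 + K) * t + suc K * t
    where
    t = suc (2 * i)
    a = z + K * (2 + K) * t + i

  triple-isGood : ∀ {z i} → IsSolution (z , suc (2 * i)) →
    let (a , b , c) = triple z i in Good a b c
  triple-isGood {z} {i} sol =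
      m≤n+m 1 a
    , +-monoʳ-< a (<-≤-trans (s≤s (s≤s z≤n)) (m≤m*n (2 + K) t))
    , m<m+n b z<s
    , sqSum-balanced (m≤m+n a _) (m≤m+n b _) balance
    where
    t = suc (2 * i)
    a = z + K * (2 + K) * t + i
    b = a + (2 + K) * t
    c = b + suc K * t
    balance-defect : ∀ K z i →
      let t = suc (2 * i) ; h = suc K * (2 + K)
          a = z + K * (2 + K) * t + i ; b = a + (2 + K) * t ; c = b + suc K * t
          G x = x * (x + 1) * (2 * x + 1)
      in 2 * (2 * G b) + t * (12 * (h * h) * (t * t) + 1)
           ≡ 2 * (G a + G c) + t * (12 * (z * z) + t * t)
    balance-defect = solve-∀
    balance : 2 * sixPyramidal b ≡ sixPyramidal a + sixPyramidal c
    balance = *-cancelˡ-≡ _ _ 2 (+-cancelʳ-≡ _ _ _ (begin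
      2 * (2 * sixPyramidal b) + t * (12 * (h * h) * (t * t) + 1)
        ≡⟨ balance-defect K z i ⟩
      2 * (sixPyramidal a + sixPyramidal c) + t * (12 * (z * z) + t * t)
        ≡⟨ cong (λ x → 2 * (sixPyramidal a + sixPyramidal c) + t * x)
                (isSolution⇒Az²+t²≡Ah²t²+1 {z} {t} sol) ⟩
      2 * (sixPyramidal a + sixPyramidal c) + t * (12 * (h * h) * (t * t) + 1) ∎))
      where open ≡-Reasoning

  triple-b∸a : ∀ z i → let (a , b , _) = triple z i in b ∸ a ≡ (2 + K) * suc (2 * i)
  triple-b∸a z i = m+n∸m≡n (z + K * (2 + K) * suc (2 * i) + i) _

  triple-c∸a : ∀ z i → let (a , _ , c) = triple z i in c ∸ a ≡ suc (2 * suc K) * suc (2 * i)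
  triple-c∸a z i = begin
    a + m + n ∸ a    ≡⟨ cong (_∸ a) (+-assoc a m n) ⟩
    a + (m + n) ∸ a  ≡⟨ m+n∸m≡n a (m + n) ⟩
    m + n            ≡⟨ add-lengths K (suc (2 * i)) ⟩
    suc (2 * suc K) * suc (2 * i) ∎
    where
    open ≡-Reasoning
    a = z + K * (2 + K) * suc (2 * i) + i
    m = (2 + K) * suc (2 * i)
    n = suc K * suc (2 * i)
    add-lengths : ∀ K t → (2 + K) * t + suc K * t ≡ suc (2 * suc K) * t
    add-lengths = solve-∀

  triple-onPlane : ∀ z i → OnPlane (balancePlane (suc K)) (triple z i)
  triple-onPlane z i = balancePlane-∋ (suc K) (triple z i) (plane-identity K z i)
    where
    plane-identity : ∀ K z i →
      let t = suc (2 * i) ; a = z + K * (2 + K) * t + i ; b = a + (2 + K) * t ; c = b + suc K * t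
      in suc K * a + suc (suc K) * c ≡ suc (2 * suc K) * b
    plane-identity = solve-∀

  i : ℕ → ℕ
  i n = proj₁ (tₙ-odd n)

  family : ℕ → Triple
  family n = triple (zₙ n) (i n)

  family-isSolution : ∀ n → IsSolution (zₙ n , suc (2 * i n))
  family-isSolution n =
    subst (λ x → IsSolution (zₙ n , x)) (proj₂ (tₙ-odd n)) (solution-isSolution n)

  family-injective : Injective _≡_ _≡_ family
  family-injective {m} {n} family-m≡family-n =
    increasing⇒injective tₙ-increasing (*-cancelˡ-≡ _ _ (2 + K) (begin
    (2 + K) * tₙ m             ≡⟨ cong ((2 + K) *_) (proj₂ (tₙ-odd m)) ⟩
    (2 + K) * suc (2 * i m)    ≡⟨ triple-b∸a (zₙ m) (i m) ⟨
    b∸a (family m)             ≡⟨ cong b∸a family-m≡family-n ⟩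
    b∸a (family n)             ≡⟨ triple-b∸a (zₙ n) (i n) ⟩
    (2 + K) * suc (2 * i n)    ≡⟨ cong ((2 + K) *_) (proj₂ (tₙ-odd n)) ⟨
    (2 + K) * tₙ n             ∎))
    where
    open ≡-Reasoning
    b∸a : Triple → ℕ
    b∸a (a , b , _) = b ∸ a

  family-isGood : ∀ n → let (a , b , c) = family n in Good a b c
  family-isGood n = triple-isGood {zₙ n} {i n} (family-isSolution n)

  family-onPlane : ∀ n → OnPlane (balancePlane (suc K)) (family n)
  family-onPlane n = triple-onPlane (zₙ n) (i n)

  family-c∸a : ∀ n → let (a , _ , c) = family n in c ∸ a ≡ suc (2 * suc K) * suc (2 * i n)
  family-c∸a n = triple-c∸a (zₙ n) (i n)

⌊1+2k/2⌋≡k : ∀ k → ⌊ suc (2 * k) /2⌋ ≡ k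
⌊1+2k/2⌋≡k zero    = refl
⌊1+2k/2⌋≡k (suc k) = cong suc (trans (cong ⌊_/2⌋ (+-suc k (k + 0))) (⌊1+2k/2⌋≡k k))

spanPlane : ℕ → Plane
spanPlane N = balancePlane ⌊ N /2⌋

theorem1p3 : (∀ N → Odd N → 3 ≤ N → ∃ λ a → ∃ λ b → ∃ λ c → Good a b c × c ∸ a ≡ N)
    × (∃ λ (Π : ℕ → Plane) →
        (∀ N → Odd N → 3 ≤ N →
          ∃ λ (t : ℕ → Triple) → Injective _≡_ _≡_ t ×
            (∀ n → let (a , b , c) = t n in
                   Good a b c × OnPlane (Π N) (t n) × Odd (c ∸ a)))
        × (∀ N M → Odd N → 3 ≤ N → Odd M → 3 ≤ M → N ≢ M →
             ¬ SamePlane (Π N) (Π M)))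
theorem1p3 = exists-span , spanPlane , infinite-family , planes-distinct
  where
  exists-span : ∀ N → Odd N → 3 ≤ N → ∃ λ a → ∃ λ b → ∃ λ c → Good a b c × c ∸ a ≡ N
  exists-span _ (zero , refl) (s≤s ())
  exists-span _ (suc K , refl) _ =
    let (a , b , c) = family 0 in a , b , c , family-isGood 0 , trans (family-c∸a 0) (*-identityʳ _)
    where open BalancedFamily K

  infinite-family : ∀ N → Odd N → 3 ≤ N → ∃ λ (t : ℕ → Triple) → Injective _≡_ _≡_ t ×
    (∀ n → let (a , b , c) = t n in Good a b c × OnPlane (spanPlane N) (t n) × Odd (c ∸ a))
  infinite-family _ (zero , refl) (s≤s ())
  infinite-family _ (suc K , refl) _ = family , family-injective , λ n →
      family-isGood n
    , subst (λ k → OnPlane (balancePlane k) (family n)) (sym (⌊1+2k/2⌋≡k (suc K)))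
            (family-onPlane n)
    , subst Odd (sym (family-c∸a n)) (Odd-* (suc K , refl) (i n , refl))
    where open BalancedFamily K

  planes-distinct : ∀ N M → Odd N → 3 ≤ N → Odd M → 3 ≤ M → N ≢ M →
    ¬ SamePlane (spanPlane N) (spanPlane M)
  planes-distinct _ _ (k , refl) _ (l , refl) _ N≢M same = N≢M (cong (λ k → suc (2 * k)) (begin
    k                 ≡⟨ ⌊1+2k/2⌋≡k k ⟨
    ⌊ suc (2 * k) /2⌋ ≡⟨ balancePlane-injective same ⟩
    ⌊ suc (2 * l) /2⌋ ≡⟨ ⌊1+2k/2⌋≡k l ⟩
    l                 ∎))
    where open ≡-Reasoning
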